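{- Let $\Pi_q$ be a projective plane of order $q$, let $1\leq t<q$, and let $\mathcal{S}$ be a $t$-semiarc in $\Pi_q$. Suppose $\ell_1,\ell_2$ are two distinct lines whose common point lies in $\mathcal{S}$, and let $n=|\ell_1\setminus(\mathcal{S}\cup\ell_2)|$ and $m=|\ell_2\setminus(\mathcal{S}\cup\ell_1)|$. Then $q\leq t+1+nm/t$, and if equality holds then $|\mathcal{S}\setminus(\ell_1\cup\ell_2)|=q-1-t$.
   Context: A non-empty point set $\mathcal{S}$ of a projective plane $\Pi_q$ of order $q$ is a $t$-semiarc if for every point $P\in\mathcal{S}$ there are exactly $t$ lines $\ell$ with $\ell\cap\mathcal{S}=\{P\}$ (the tangents to $\mathcal{S}$ at $P$). -}

module Defs where

open import Data.Nat using (ℕ; zero; suc; _+_)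
open import Data.Bool using (Bool; true; false; if_then_else_; _∧_; not; _∨_)
open import Data.Fin using (Fin; zero; suc)
open import Data.Fin.Properties using () renaming (_≟_ to _≟ᶠ_)
open import Data.Product using (Σ; ∃; ∃!; _×_; _,_)
open import Relation.Binary.PropositionalEquality using (_≡_; _≢_)
open import Relation.Nullary using (¬_)
open import Relation.Nullary.Decidable using (⌊_⌋)

count : {n : ℕ} → (Fin n → Bool) → ℕ
count {zero}  p = 0
count {suc n} p = (if p zero then 1 else 0) + count (λ i → p (suc i))

allᶠ : {n : ℕ} → (Fin n → Bool) → Bool
allᶠ {zero}  p = true
allᶠ {suc n} p = p zero ∧ allᶠ (λ i → p (suc i))

record ProjectivePlane (q : ℕ) : Set where
  field
    nP nL : ℕ
    _I_ : Fin nP → Fin nL → Bool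
    two-points : ∀ (P Q : Fin nP) → P ≢ Q →
      ∃! _≡_ (λ ℓ → (P I ℓ ≡ true) × (Q I ℓ ≡ true))
    two-lines : ∀ (ℓ m : Fin nL) → ℓ ≢ m →
      ∃! _≡_ (λ P → (P I ℓ ≡ true) × (P I m ≡ true))
    quadrangle : Σ (Fin 4 → Fin nP) λ f →
      (∀ i j → i ≢ j → f i ≢ f j) ×
      (∀ i j k → i ≢ j → j ≢ k → i ≢ k →
        ¬ (∃ λ ℓ → (f i I ℓ ≡ true) × (f j I ℓ ≡ true) × (f k I ℓ ≡ true)))
    order : ∀ (ℓ : Fin nL) → count (λ P → P I ℓ) ≡ suc q

module _ {q : ℕ} (Π : ProjectivePlane q) where
  open ProjectivePlane Π

  -- ℓ ∩ S = {P}  (ℓ is a tangent to S at P)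
  isTangent : (Fin nP → Bool) → Fin nP → Fin nL → Bool
  isTangent S P ℓ = allᶠ (λ Q → (Q I ℓ ∧ S Q) ≡ᵇ ⌊ Q ≟ᶠ P ⌋)
    where
    _≡ᵇ_ : Bool → Bool → Bool
    true  ≡ᵇ b = b
    false ≡ᵇ b = not b

  IsSemiarc : ℕ → (Fin nP → Bool) → Set
  IsSemiarc t S = (∃ λ P → S P ≡ true) ×
    (∀ P → S P ≡ true → count (λ ℓ → isTangent S P ℓ) ≡ t)

-- Let P = ℓ₁ ∩ ℓ₂ ∈ S and let K = S ∖ (ℓ₁ ∪ ℓ₂), A = ℓ₁ ∖ (S ∪ ℓ₂), B = ℓ₂ ∖ (S ∪ ℓ₁),
-- so n = |A| and m = |B|.
--
-- (1) q ≤ t + 1 + |K|.  A line M avoiding P has q - 1 points off ℓ₁ ∪ ℓ₂, and joining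
-- them to P gives distinct lines of the pencil at P other than ℓ₁, ℓ₂.  At most t of
-- these are tangents at P; every other one carries a second point of S, which lies in
-- K and determines the line.
--
-- (2) t |K| ≤ n m.  A tangent at a point of K contains no other point of S, so it meets
-- ℓ₁ in A and ℓ₂ in B.  Such a tangent is tangent at only one point of K, and through a
-- point of A there is at most one such tangent for each point of B; double counting
-- gives t |K| ≤ |{tangents at points of K}| ≤ |A| |B|.
--
-- Hence q t ≤ (t + 1 + |K|) t ≤ (t + 1) t + n m, and equality forces q = t + 1 + |K|.
module Submission where

open import Defs
open import Data.Nat using (ℕ; suc; _+_; _*_; _∸_; _≤_; _<_)
open import Data.Bool using (Bool; true; not; _∧_; _∨_)
open import Data.Fin using (Fin)
open import Data.Product using (∃; _×_)
open import Relation.Binary.PropositionalEquality using (_≡_; _≢_)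

open import Data.Bool using (false; if_then_else_)
open import Data.Bool.Properties using (¬-not; not-¬; ∧-distribˡ-∨) renaming (_≟_ to _≟ᵇ_)
open import Data.Fin using (zero; suc)
open import Data.Fin.Properties using (suc-injective; any?) renaming (_≟_ to _≟ᶠ_)
open import Data.Nat using (zero; z≤n; s≤s; >-nonZero)
open import Data.Nat.Properties hiding (suc-injective; _≟_)
open import Algebra.Properties.CommutativeSemigroup +-commutativeSemigroup using (interchange)
open import Algebra.Properties.Monoid.Sum +-0-monoid using (sum; sum-replicate-zero)
open import Data.Nat.Tactic.RingSolver using (solve-∀)
open import Data.Product using (_,_; proj₁; proj₂)
open import Function using (_∘_)
open import Relation.Nullary using (Dec; yes; no; does; contradiction)
open import Relation.Nullary.Decidable using (dec-true; dec-false; ¬?; _×-dec_; decidable-stable)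
open import Relation.Binary.PropositionalEquality using (refl; sym; trans; cong; cong₂; subst; subst₂; module ≡-Reasoning)

∧-true : ∀ {a b} → a ∧ b ≡ true → a ≡ true × b ≡ true
∧-true {true}  b≡true = refl , b≡true
∧-true {false} ()

∧-not-true : ∀ {a b} → a ∧ not b ≡ true → a ≡ true × b ≡ false
∧-not-true {true}  {false} _  = refl , refl
∧-not-true {true}  {true}  ()
∧-not-true {false}         ()

∧-not-∨-true : ∀ {a b c} → a ∧ not (b ∨ c) ≡ true → a ≡ true × b ≡ false × c ≡ false
∧-not-∨-true {true}  {false} {false} _  = refl , refl , refl
∧-not-∨-true {true}  {false} {true}  ()
∧-not-∨-true {true}  {true}          ()
∧-not-∨-true {false}                 ()

∧-not-∨-intro : ∀ {a b c} → a ≡ true → b ≡ false → c ≡ false → a ∧ not (b ∨ c) ≡ true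
∧-not-∨-intro refl refl refl = refl

does-true : ∀ {a} {A : Set a} (a? : Dec A) → does a? ≡ true → A
does-true (yes a) _  = a
does-true (no _)  ()

allᶠ-true : ∀ {n} (g : Fin n → Bool) → allᶠ g ≡ true → ∀ i → g i ≡ true
allᶠ-true g all zero    = proj₁ (∧-true all)
allᶠ-true g all (suc i) = allᶠ-true (g ∘ suc) (proj₂ (∧-true all)) i

allᶠ-false : ∀ {n} (g : Fin n → Bool) → allᶠ g ≡ false → ∃ λ i → g i ≡ false
allᶠ-false {zero}  g ()
allᶠ-false {suc n} g notAll with g zero in g₀
... | false = zero , g₀
... | true  = let i , gᵢ = allᶠ-false (g ∘ suc) notAll in suc i , gᵢ

count-const-false : ∀ n → count {n} (λ _ → false) ≡ 0
count-const-false zero    = refl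
count-const-false (suc n) = count-const-false n

count-mono : ∀ {n} {p r : Fin n → Bool} → (∀ i → p i ≡ true → r i ≡ true) → count p ≤ count r
count-mono {zero}          _   = z≤n
count-mono {suc n} {p} {r} p⊆r with p zero in p₀ | r zero in r₀
... | true  | true  = s≤s (count-mono (p⊆r ∘ suc))
... | true  | false = contradiction (p⊆r zero p₀) (not-¬ r₀)
... | false | true  = m≤n⇒m≤1+n (count-mono (p⊆r ∘ suc))
... | false | false = count-mono (p⊆r ∘ suc)

count-≤1 : ∀ {n} {p : Fin n → Bool} → (∀ i j → p i ≡ true → p j ≡ true → i ≡ j) → count p ≤ 1
count-≤1 {zero}      _      = z≤n
count-≤1 {suc n} {p} unique with p zero in p₀
... | true  = s≤s (≤-trans (count-mono {r = λ _ → false} λ i pᵢ → contradiction (unique zero (suc i) p₀ pᵢ) λ ())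
                           (≤-reflexive (count-const-false n)))
... | false = count-≤1 λ i j pᵢ pⱼ → suc-injective (unique (suc i) (suc j) pᵢ pⱼ)

count-pos : ∀ {n} {p : Fin n → Bool} i → p i ≡ true → 1 ≤ count p
count-pos zero    pᵢ rewrite pᵢ = s≤s z≤n
count-pos (suc i) pᵢ = ≤-trans (count-pos i pᵢ) (m≤n+m _ _)

count-split : ∀ {n} (p c : Fin n → Bool) →
  count p ≡ count (λ i → p i ∧ c i) + count (λ i → p i ∧ not (c i))
count-split {zero}  p c = refl
count-split {suc n} p c with p zero | c zero | count-split (p ∘ suc) (c ∘ suc)
... | true  | true  | split = cong suc split
... | true  | false | split = trans (cong suc split) (sym (+-suc _ _))
... | false | _     | split = split

count-∨ : ∀ {n} (p r : Fin n → Bool) → count (λ i → p i ∨ r i) ≤ count p + count r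
count-∨ {zero}  p r = z≤n
count-∨ {suc n} p r with p zero | r zero | count-∨ (p ∘ suc) (r ∘ suc)
... | true  | true  | ih = s≤s (≤-trans ih (+-monoʳ-≤ (count (p ∘ suc)) (n≤1+n _)))
... | true  | false | ih = s≤s ih
... | false | true  | ih = ≤-trans (s≤s ih) (≤-reflexive (sym (+-suc _ _)))
... | false | false | ih = ih

count≥2⇒other : ∀ {n} {p : Fin n → Bool} (a : Fin n) → 2 ≤ count p → ∃ λ i → i ≢ a × p i ≡ true
count≥2⇒other {p = p} a 2≤count with any? (λ i → ¬? (i ≟ᶠ a) ×-dec (p i ≟ᵇ true))
... | yes found = found
... | no  none  = contradiction (count-≤1 λ i j pᵢ pⱼ → trans (equal i pᵢ) (sym (equal j pⱼ))) (<⇒≱ 2≤count)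
  where
  equal : ∀ i → p i ≡ true → i ≡ a
  equal i pᵢ = decidable-stable (i ≟ᶠ a) λ i≢a → none (i , i≢a , pᵢ)

sum-mono-≤ : ∀ {n} {f g : Fin n → ℕ} → (∀ i → f i ≤ g i) → sum f ≤ sum g
sum-mono-≤ {zero}  _   = z≤n
sum-mono-≤ {suc n} f≤g = +-mono-≤ (f≤g zero) (sum-mono-≤ (f≤g ∘ suc))

sum-distrib-+ : ∀ {n} (f g : Fin n → ℕ) → sum (λ i → f i + g i) ≡ sum f + sum g
sum-distrib-+ {zero}  f g = refl
sum-distrib-+ {suc n} f g =
  trans (cong (f zero + g zero +_) (sum-distrib-+ (f ∘ suc) (g ∘ suc)))
        (interchange (f zero) (g zero) (sum (f ∘ suc)) (sum (g ∘ suc)))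

sum-if : ∀ {n} (p : Fin n → Bool) c → sum (λ i → if p i then c else 0) ≡ count p * c
sum-if {zero}  p c = refl
sum-if {suc n} p c with p zero
... | true  = cong (c +_) (sum-if (p ∘ suc) c)
... | false = sum-if (p ∘ suc) c

sum-count-comm : ∀ {a b} (f : Fin a → Fin b → Bool) →
  sum (λ i → count (f i)) ≡ sum (λ j → count (λ i → f i j))
sum-count-comm {zero}  {b} f = sym (sum-replicate-zero b)
sum-count-comm {suc a} {b} f = begin
  count (f zero) + sum (λ i → count (f (suc i)))
    ≡⟨ cong₂ _+_ (trans (sym (*-identityʳ _)) (sym (sum-if (f zero) 1))) (sum-count-comm (f ∘ suc)) ⟩
  sum (λ j → if f zero j then 1 else 0) + sum (λ j → count (λ i → f (suc i) j))
    ≡⟨ sum-distrib-+ (λ j → if f zero j then 1 else 0) (λ j → count (λ i → f (suc i) j)) ⟨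
  sum (λ j → count (λ i → f i j)) ∎
  where open ≡-Reasoning

double-counting : ∀ {a b} (p : Fin a → Bool) (r : Fin b → Bool) (R : Fin a → Fin b → Bool) {c d : ℕ} →
  (∀ i → p i ≡ true → c ≤ count (λ j → r j ∧ R i j)) →
  (∀ j → r j ≡ true → count (λ i → p i ∧ R i j) ≤ d) →
  count p * c ≤ count r * d
double-counting {a} p r R {c} {d} lower upper = begin
  count p * c                                    ≡⟨ sum-if p c ⟨
  sum (λ i → if p i then c else 0)               ≤⟨ sum-mono-≤ row ⟩
  sum (λ i → count (λ j → r j ∧ (p i ∧ R i j)))  ≡⟨ sum-count-comm (λ i j → r j ∧ (p i ∧ R i j)) ⟩
  sum (λ j → count (λ i → r j ∧ (p i ∧ R i j)))  ≤⟨ sum-mono-≤ column ⟩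
  sum (λ j → if r j then d else 0)               ≡⟨ sum-if r d ⟩
  count r * d                                    ∎
  where
  open ≤-Reasoning
  row : ∀ i → (if p i then c else 0) ≤ count (λ j → r j ∧ (p i ∧ R i j))
  row i with p i in pᵢ
  ... | true  = lower i pᵢ
  ... | false = z≤n
  column : ∀ j → count (λ i → r j ∧ (p i ∧ R i j)) ≤ (if r j then d else 0)
  column j with r j in rⱼ
  ... | true  = upper j rⱼ
  ... | false = ≤-reflexive (count-const-false a)

count-≤-by-injection : ∀ {a b} {p : Fin a → Bool} {r : Fin b → Bool} (R : Fin a → Fin b → Bool) →
  (∀ i → p i ≡ true → ∃ λ j → r j ≡ true × R i j ≡ true) →
  (∀ {i i' j} → p i ≡ true → p i' ≡ true → r j ≡ true → R i j ≡ true → R i' j ≡ true → i ≡ i') →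
  count p ≤ count r
count-≤-by-injection {p = p} {r} R image injective =
  subst₂ _≤_ (*-identityʳ _) (*-identityʳ _) (double-counting p r R lower upper)
  where
  lower : ∀ i → p i ≡ true → 1 ≤ count (λ j → r j ∧ R i j)
  lower i pᵢ = let j , rⱼ , Rᵢⱼ = image i pᵢ in count-pos j (cong₂ _∧_ rⱼ Rᵢⱼ)
  upper : ∀ j → r j ≡ true → count (λ i → p i ∧ R i j) ≤ 1
  upper j rⱼ = count-≤1 λ i i' h h' →
    injective (proj₁ (∧-true h)) (proj₁ (∧-true h')) rⱼ (proj₂ (∧-true h)) (proj₂ (∧-true h'))

module PlaneGeometry {q : ℕ} (Π : ProjectivePlane q) where
  open ProjectivePlane Π

  infix 4 _∈_ _∉_
  _∈_ _∉_ : Fin nP → Fin nL → Set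
  X ∈ ℓ = X I ℓ ≡ true
  X ∉ ℓ = X I ℓ ≡ false

  separating-point : ∀ {X ℓ ℓ'} → X ∈ ℓ → X ∉ ℓ' → ℓ ≢ ℓ'
  separating-point X∈ℓ X∉ℓ' refl = not-¬ X∈ℓ X∉ℓ'

  separating-line : ∀ {X Y ℓ} → X ∈ ℓ → Y ∉ ℓ → X ≢ Y
  separating-line X∈ℓ Y∉ℓ refl = not-¬ X∈ℓ Y∉ℓ

  line-unique : ∀ {X Y ℓ ℓ'} → X ≢ Y → X ∈ ℓ → Y ∈ ℓ → X ∈ ℓ' → Y ∈ ℓ' → ℓ ≡ ℓ'
  line-unique {X} {Y} X≢Y X∈ℓ Y∈ℓ X∈ℓ' Y∈ℓ' =
    let _ , _ , unique = two-points X Y X≢Y in trans (sym (unique (X∈ℓ , Y∈ℓ))) (unique (X∈ℓ' , Y∈ℓ'))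

  point-unique : ∀ {ℓ ℓ' X Y} → ℓ ≢ ℓ' → X ∈ ℓ → X ∈ ℓ' → Y ∈ ℓ → Y ∈ ℓ' → X ≡ Y
  point-unique {ℓ} {ℓ'} ℓ≢ℓ' X∈ℓ X∈ℓ' Y∈ℓ Y∈ℓ' =
    let _ , _ , unique = two-lines ℓ ℓ' ℓ≢ℓ' in trans (sym (unique (X∈ℓ , X∈ℓ'))) (unique (Y∈ℓ , Y∈ℓ'))

  join : ∀ {X Y} → X ≢ Y → ∃ λ ℓ → X ∈ ℓ × Y ∈ ℓ
  join {X} {Y} X≢Y = let ℓ , incident , _ = two-points X Y X≢Y in ℓ , incident

  meet : ∀ {ℓ ℓ'} → ℓ ≢ ℓ' → ∃ λ X → X ∈ ℓ × X ∈ ℓ'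
  meet {ℓ} {ℓ'} ℓ≢ℓ' = let X , incident , _ = two-lines ℓ ℓ' ℓ≢ℓ' in X , incident

  lines-meet-at-most-once : ∀ {ℓ ℓ'} → ℓ ≢ ℓ' → count (λ X → X I ℓ ∧ X I ℓ') ≤ 1
  lines-meet-at-most-once ℓ≢ℓ' = count-≤1 λ X Y X∈ Y∈ →
    point-unique ℓ≢ℓ' (proj₁ (∧-true X∈)) (proj₂ (∧-true X∈)) (proj₁ (∧-true Y∈)) (proj₂ (∧-true Y∈))

  another-point : 1 ≤ q → ∀ ℓ X → ∃ λ Y → Y ≢ X × Y ∈ ℓ
  another-point 1≤q ℓ X = count≥2⇒other X (subst (2 ≤_) (sym (order ℓ)) (s≤s 1≤q))

  line-avoiding : 1 ≤ q → ∀ {ℓ ℓ' P} → ℓ ≢ ℓ' → P ∈ ℓ → P ∈ ℓ' → ∃ λ M → P ∉ M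
  line-avoiding 1≤q {ℓ} {ℓ'} {P} ℓ≢ℓ' P∈ℓ P∈ℓ'
    with X , X≢P , X∈ℓ  ← another-point 1≤q ℓ P
       | Y , Y≢P , Y∈ℓ' ← another-point 1≤q ℓ' P
    with M , X∈M , Y∈M ← join {X} {Y} (λ X≡Y → X≢P (point-unique ℓ≢ℓ' X∈ℓ (subst (_∈ ℓ') (sym X≡Y) Y∈ℓ') P∈ℓ P∈ℓ'))
    = M , ¬-not λ P∈M →
        Y≢P (point-unique ℓ≢ℓ' (subst (Y ∈_) (sym (line-unique (X≢P ∘ sym) P∈ℓ X∈ℓ P∈M X∈M)) Y∈M) Y∈ℓ' P∈ℓ P∈ℓ')

  offPoints : Fin nL → Fin nL → Fin nL → Fin nP → Bool
  offPoints M ℓ ℓ' Z = Z I M ∧ not (Z I ℓ ∨ Z I ℓ')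

  pencil : Fin nP → Fin nL → Fin nL → Fin nL → Bool
  pencil P ℓ ℓ' τ = P I τ ∧ not (does (τ ≟ᶠ ℓ) ∨ does (τ ≟ᶠ ℓ'))

  pencil-spec : ∀ {P ℓ ℓ' τ} → pencil P ℓ ℓ' τ ≡ true → P ∈ τ × τ ≢ ℓ × τ ≢ ℓ'
  pencil-spec {τ = τ} h = let P∈τ , τ≠ℓ , τ≠ℓ' = ∧-not-∨-true h in
    P∈τ , (λ τ≡ℓ → not-¬ (dec-true (τ ≟ᶠ _) τ≡ℓ) τ≠ℓ) , (λ τ≡ℓ' → not-¬ (dec-true (τ ≟ᶠ _) τ≡ℓ') τ≠ℓ')

  count-offPoints-≥ : ∀ {M ℓ ℓ'} → M ≢ ℓ → M ≢ ℓ' → suc q ≤ 2 + count (offPoints M ℓ ℓ')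
  count-offPoints-≥ {M} {ℓ} {ℓ'} M≢ℓ M≢ℓ' = begin
    suc q                                                          ≡⟨ order M ⟨
    count (λ Z → Z I M)                                            ≡⟨ count-split (λ Z → Z I M) (λ Z → Z I ℓ ∨ Z I ℓ') ⟩
    count (λ Z → Z I M ∧ (Z I ℓ ∨ Z I ℓ')) + count (offPoints M ℓ ℓ') ≤⟨ +-monoˡ-≤ _ on-ℓ∪ℓ' ⟩
    2 + count (offPoints M ℓ ℓ')                                   ∎
    where
    open ≤-Reasoning
    on-ℓ∪ℓ' : count (λ Z → Z I M ∧ (Z I ℓ ∨ Z I ℓ')) ≤ 2
    on-ℓ∪ℓ' = begin
      count (λ Z → Z I M ∧ (Z I ℓ ∨ Z I ℓ'))           ≤⟨ count-mono (λ Z h → trans (sym (∧-distribˡ-∨ (Z I M) (Z I ℓ) (Z I ℓ'))) h) ⟩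
      count (λ Z → Z I M ∧ Z I ℓ ∨ Z I M ∧ Z I ℓ')     ≤⟨ count-∨ (λ Z → Z I M ∧ Z I ℓ) (λ Z → Z I M ∧ Z I ℓ') ⟩
      count (λ Z → Z I M ∧ Z I ℓ) + count (λ Z → Z I M ∧ Z I ℓ')
                                                      ≤⟨ +-mono-≤ (lines-meet-at-most-once M≢ℓ) (lines-meet-at-most-once M≢ℓ') ⟩
      2                                               ∎

  offPoints-≤-pencil : ∀ {P M ℓ ℓ'} → P ∉ M → count (offPoints M ℓ ℓ') ≤ count (pencil P ℓ ℓ')
  offPoints-≤-pencil {P} {M} {ℓ} {ℓ'} P∉M = count-≤-by-injection (λ Z τ → Z I τ) image injective
    where
    image : ∀ Z → offPoints M ℓ ℓ' Z ≡ true → ∃ λ τ → pencil P ℓ ℓ' τ ≡ true × Z ∈ τ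
    image Z h = let Z∈M , Z∉ℓ , Z∉ℓ' = ∧-not-∨-true h
                    τ , P∈τ , Z∈τ = join (separating-line Z∈M P∉M ∘ sym)
                in τ , ∧-not-∨-intro P∈τ (dec-false (τ ≟ᶠ ℓ) (separating-point Z∈τ Z∉ℓ))
                                        (dec-false (τ ≟ᶠ ℓ') (separating-point Z∈τ Z∉ℓ')) , Z∈τ
    injective : ∀ {Z Z' τ} → offPoints M ℓ ℓ' Z ≡ true → offPoints M ℓ ℓ' Z' ≡ true →
      pencil P ℓ ℓ' τ ≡ true → Z ∈ τ → Z' ∈ τ → Z ≡ Z'
    injective h h' τ-pencil Z∈τ Z'∈τ =
      point-unique (separating-point (proj₁ (pencil-spec τ-pencil)) P∉M)
        Z∈τ (proj₁ (∧-true h)) Z'∈τ (proj₁ (∧-true h'))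

module SemiarcGeometry {q : ℕ} (Π : ProjectivePlane q) (S : Fin (ProjectivePlane.nP Π) → Bool) where
  open ProjectivePlane Π
  open PlaneGeometry Π

  tangent-spec : ∀ {R τ} → isTangent Π S R τ ≡ true → ∀ Q → Q I τ ∧ S Q ≡ does (Q ≟ᶠ R)
  tangent-spec {R} {τ} tan Q with Q I τ ∧ S Q | Q ≟ᶠ R | allᶠ-true _ tan Q
  ... | true  | yes _ | _  = refl
  ... | false | no _  | _  = refl
  ... | true  | no _  | ()
  ... | false | yes _ | ()

  secant : ∀ {R τ} → R ∈ τ → S R ≡ true → isTangent Π S R τ ≡ false →
    ∃ λ Q → Q ≢ R × Q ∈ τ × S Q ≡ true
  secant {R} {τ} R∈τ R∈S notTangent with allᶠ-false _ notTangent
  ... | Q , notAlone with Q I τ ∧ S Q in Q∈τ∩S | Q ≟ᶠ R | notAlone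
  ... | true  | no Q≢R   | _  = Q , Q≢R , ∧-true Q∈τ∩S
  ... | false | no _     | ()
  ... | true  | yes _    | ()
  ... | false | yes refl | _  = contradiction (trans (sym Q∈τ∩S) (cong₂ _∧_ R∈τ R∈S)) λ ()

  tangent-incident : ∀ {R τ} → isTangent Π S R τ ≡ true → R ∈ τ × S R ≡ true
  tangent-incident {R} tan = ∧-true (trans (tangent-spec tan R) (dec-true (R ≟ᶠ R) refl))

  tangent-unique : ∀ {R τ Q} → isTangent Π S R τ ≡ true → Q ∈ τ → S Q ≡ true → Q ≡ R
  tangent-unique {R} {Q = Q} tan Q∈τ Q∈S =
    does-true (Q ≟ᶠ R) (trans (sym (tangent-spec tan Q)) (cong₂ _∧_ Q∈τ Q∈S))

  outside : Fin nL → Fin nL → Fin nP → Bool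
  outside ℓ ℓ' X = X I ℓ ∧ not (S X ∨ X I ℓ')

  outside-spec : ∀ {ℓ ℓ' X} → outside ℓ ℓ' X ≡ true → X ∈ ℓ × S X ≡ false × X ∉ ℓ'
  outside-spec {ℓ} {ℓ'} {X} = ∧-not-∨-true {X I ℓ} {S X} {X I ℓ'}

  tangent-meets-outside : ∀ {R τ ℓ ℓ' P} → isTangent Π S R τ ≡ true → R ∉ ℓ →
    ℓ ≢ ℓ' → P ∈ ℓ → P ∈ ℓ' → S P ≡ true → ∃ λ X → X ∈ τ × outside ℓ ℓ' X ≡ true
  tangent-meets-outside {ℓ = ℓ} tan R∉ℓ ℓ≢ℓ' P∈ℓ P∈ℓ' P∈S =
    let X , X∈τ , X∈ℓ = meet (separating-point (proj₁ (tangent-incident tan)) R∉ℓ)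
        X∉S = ¬-not λ X∈S → not-¬ (subst (_∈ ℓ) (tangent-unique tan X∈τ X∈S) X∈ℓ) R∉ℓ
        X∉ℓ' = ¬-not λ X∈ℓ' → not-¬ (subst (λ Y → S Y ≡ true) (sym (point-unique ℓ≢ℓ' X∈ℓ X∈ℓ' P∈ℓ P∈ℓ')) P∈S) X∉S
    in X , X∈τ , ∧-not-∨-intro X∈ℓ X∉S X∉ℓ'

module Configuration {q t : ℕ} (Π : ProjectivePlane q) (S : Fin (ProjectivePlane.nP Π) → Bool)
  (tangents : ∀ R → S R ≡ true → count (isTangent Π S R) ≡ t)
  {ℓ₁ ℓ₂ : Fin (ProjectivePlane.nL Π)} (ℓ₁≢ℓ₂ : ℓ₁ ≢ ℓ₂) {P : Fin (ProjectivePlane.nP Π)}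
  (P∈ℓ₁ : ProjectivePlane._I_ Π P ℓ₁ ≡ true) (P∈ℓ₂ : ProjectivePlane._I_ Π P ℓ₂ ≡ true) (P∈S : S P ≡ true)
  where
  open ProjectivePlane Π
  open PlaneGeometry Π
  open SemiarcGeometry Π S

  K : Fin nP → Bool
  K R = S R ∧ not (R I ℓ₁ ∨ R I ℓ₂)

  K-spec : ∀ {R} → K R ≡ true → S R ≡ true × R ∉ ℓ₁ × R ∉ ℓ₂
  K-spec {R} = ∧-not-∨-true {S R} {R I ℓ₁} {R I ℓ₂}

  tangentAtK : Fin nL → Bool
  tangentAtK τ = does (any? λ R → K R ∧ isTangent Π S R τ ≟ᵇ true)

  secants-≤-K : count (λ τ → pencil P ℓ₁ ℓ₂ τ ∧ not (isTangent Π S P τ)) ≤ count K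
  secants-≤-K = count-≤-by-injection (λ τ Q → Q I τ) image injective
    where
    image : ∀ τ → pencil P ℓ₁ ℓ₂ τ ∧ not (isTangent Π S P τ) ≡ true → ∃ λ Q → K Q ≡ true × Q ∈ τ
    image τ h =
      let τ-pencil , notTangent = ∧-not-true h
          P∈τ , τ≢ℓ₁ , τ≢ℓ₂ = pencil-spec τ-pencil
          Q , Q≢P , Q∈τ , Q∈S = secant P∈τ P∈S notTangent
          Q∉ : ∀ {ℓ} → τ ≢ ℓ → P ∈ ℓ → Q ∉ ℓ
          Q∉ τ≢ℓ P∈ℓ = ¬-not λ Q∈ℓ → Q≢P (point-unique τ≢ℓ Q∈τ Q∈ℓ P∈τ P∈ℓ)
      in Q , ∧-not-∨-intro Q∈S (Q∉ τ≢ℓ₁ P∈ℓ₁) (Q∉ τ≢ℓ₂ P∈ℓ₂) , Q∈τ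
    injective : ∀ {τ τ' Q} → pencil P ℓ₁ ℓ₂ τ ∧ not (isTangent Π S P τ) ≡ true →
      pencil P ℓ₁ ℓ₂ τ' ∧ not (isTangent Π S P τ') ≡ true → K Q ≡ true → Q ∈ τ → Q ∈ τ' → τ ≡ τ'
    injective h h' Q∈K Q∈τ Q∈τ' =
      line-unique (separating-line P∈ℓ₁ (proj₁ (proj₂ (K-spec Q∈K))) ∘ sym)
        Q∈τ (proj₁ (pencil-spec (proj₁ (∧-not-true h)))) Q∈τ' (proj₁ (pencil-spec (proj₁ (∧-not-true h'))))

  pencil-≤-t+K : count (pencil P ℓ₁ ℓ₂) ≤ t + count K
  pencil-≤-t+K = begin
    count (pencil P ℓ₁ ℓ₂)                                   ≡⟨ count-split (pencil P ℓ₁ ℓ₂) (isTangent Π S P) ⟩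
    count (λ τ → pencil P ℓ₁ ℓ₂ τ ∧ isTangent Π S P τ) +
    count (λ τ → pencil P ℓ₁ ℓ₂ τ ∧ not (isTangent Π S P τ)) ≤⟨ +-mono-≤ tangents-at-P secants-≤-K ⟩
    t + count K                                              ∎
    where
    open ≤-Reasoning
    tangents-at-P : count (λ τ → pencil P ℓ₁ ℓ₂ τ ∧ isTangent Π S P τ) ≤ t
    tangents-at-P = ≤-trans (count-mono {r = isTangent Π S P} λ τ h → proj₂ (∧-true h)) (≤-reflexive (tangents P P∈S))

  q≤suc[t+K] : 1 ≤ q → q ≤ suc (t + count K)
  q≤suc[t+K] 1≤q with M , P∉M ← line-avoiding 1≤q ℓ₁≢ℓ₂ P∈ℓ₁ P∈ℓ₂ = ≤-pred (begin
    suc q                           ≤⟨ count-offPoints-≥ (separating-point P∈ℓ₁ P∉M ∘ sym) (separating-point P∈ℓ₂ P∉M ∘ sym) ⟩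
    2 + count (offPoints M ℓ₁ ℓ₂)   ≤⟨ +-monoʳ-≤ 2 (offPoints-≤-pencil P∉M) ⟩
    2 + count (pencil P ℓ₁ ℓ₂)      ≤⟨ +-monoʳ-≤ 2 pencil-≤-t+K ⟩
    2 + (t + count K)               ∎)
    where open ≤-Reasoning

  tangentAtK-intro : ∀ {R τ} → K R ≡ true → isTangent Π S R τ ≡ true → tangentAtK τ ≡ true
  tangentAtK-intro {R} R∈K tan = dec-true (any? _) (R , cong₂ _∧_ R∈K tan)

  tangentAtK-elim : ∀ {τ} → tangentAtK τ ≡ true → ∃ λ R → K R ≡ true × isTangent Π S R τ ≡ true
  tangentAtK-elim τ∈ = let R , h = does-true (any? _) τ∈ in R , ∧-true h

  K*t≤tangentAtK : count K * t ≤ count tangentAtK * 1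
  K*t≤tangentAtK = double-counting K tangentAtK (λ R τ → isTangent Π S R τ) lower upper
    where
    lower : ∀ R → K R ≡ true → t ≤ count (λ τ → tangentAtK τ ∧ isTangent Π S R τ)
    lower R R∈K = ≤-trans (≤-reflexive (sym (tangents R (proj₁ (K-spec R∈K)))))
      (count-mono {p = isTangent Π S R} λ τ tan → cong₂ _∧_ (tangentAtK-intro R∈K tan) tan)
    upper : ∀ τ → tangentAtK τ ≡ true → count (λ R → K R ∧ isTangent Π S R τ) ≤ 1
    upper τ _ = count-≤1 λ R R' h h' →
      let R∈τ , R∈S = tangent-incident (proj₂ (∧-true h)) in tangent-unique (proj₂ (∧-true h')) R∈τ R∈S

  tangentAtK≤outside*outside : count tangentAtK * 1 ≤ count (outside ℓ₁ ℓ₂) * count (outside ℓ₂ ℓ₁)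
  tangentAtK≤outside*outside = double-counting tangentAtK (outside ℓ₁ ℓ₂) (λ τ X → X I τ) lower upper
    where
    meets-outside : ∀ {τ ℓ ℓ'} → tangentAtK τ ≡ true → ℓ ≢ ℓ' → P ∈ ℓ → P ∈ ℓ' →
      (∀ {R} → K R ≡ true → R ∉ ℓ) → ∃ λ X → X ∈ τ × outside ℓ ℓ' X ≡ true
    meets-outside τ∈ ℓ≢ℓ' P∈ℓ P∈ℓ' K∉ℓ =
      let R , R∈K , tan = tangentAtK-elim τ∈ in tangent-meets-outside tan (K∉ℓ R∈K) ℓ≢ℓ' P∈ℓ P∈ℓ' P∈S
    lower : ∀ τ → tangentAtK τ ≡ true → 1 ≤ count (λ X → outside ℓ₁ ℓ₂ X ∧ X I τ)
    lower τ τ∈ = let X , X∈τ , X-out = meets-outside τ∈ ℓ₁≢ℓ₂ P∈ℓ₁ P∈ℓ₂ (proj₁ ∘ proj₂ ∘ K-spec)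
                 in count-pos X (cong₂ _∧_ X-out X∈τ)
    upper : ∀ X → outside ℓ₁ ℓ₂ X ≡ true → count (λ τ → tangentAtK τ ∧ X I τ) ≤ count (outside ℓ₂ ℓ₁)
    upper X X-out = count-≤-by-injection (λ τ Y → Y I τ) image injective
      where
      image : ∀ τ → tangentAtK τ ∧ X I τ ≡ true → ∃ λ Y → outside ℓ₂ ℓ₁ Y ≡ true × Y ∈ τ
      image τ h = let Y , Y∈τ , Y-out = meets-outside (proj₁ (∧-true h)) (ℓ₁≢ℓ₂ ∘ sym) P∈ℓ₂ P∈ℓ₁
                                          (proj₂ ∘ proj₂ ∘ K-spec)
                  in Y , Y-out , Y∈τ
      injective : ∀ {τ τ' Y} → tangentAtK τ ∧ X I τ ≡ true → tangentAtK τ' ∧ X I τ' ≡ true →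
        outside ℓ₂ ℓ₁ Y ≡ true → Y ∈ τ → Y ∈ τ' → τ ≡ τ'
      injective h h' Y-out Y∈τ Y∈τ' =
        line-unique (separating-line (proj₁ (outside-spec Y-out)) (proj₂ (proj₂ (outside-spec X-out))) ∘ sym)
          (proj₂ (∧-true h)) Y∈τ (proj₂ (∧-true h')) Y∈τ'

  K*t≤outside*outside : count K * t ≤ count (outside ℓ₁ ℓ₂) * count (outside ℓ₂ ℓ₁)
  K*t≤outside*outside = ≤-trans K*t≤tangentAtK tangentAtK≤outside*outside

suc[t+k]*t≡[t+1]*t+k*t : ∀ t k → suc (t + k) * t ≡ (t + 1) * t + k * t
suc[t+k]*t≡[t+1]*t+k*t = solve-∀

q*t-bound-with-equality : ∀ {q t k N} → 1 ≤ t → q ≤ suc (t + k) → k * t ≤ N →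
  (q * t ≤ (t + 1) * t + N) × (q * t ≡ (t + 1) * t + N → k ≡ q ∸ 1 ∸ t)
q*t-bound-with-equality {q} {t} {k} {N} 1≤t q≤ k*t≤N = ≤-trans (*-monoˡ-≤ t q≤) suc[t+k]*t≤ , equality
  where
  suc[t+k]*t≤ : suc (t + k) * t ≤ (t + 1) * t + N
  suc[t+k]*t≤ = ≤-trans (≤-reflexive (suc[t+k]*t≡[t+1]*t+k*t t k)) (+-monoʳ-≤ ((t + 1) * t) k*t≤N)
  equality : q * t ≡ (t + 1) * t + N → k ≡ q ∸ 1 ∸ t
  equality q*t≡ = sym (trans (cong (λ x → x ∸ 1 ∸ t) q≡) (m+n∸m≡n t k))
    where
    instance _ = >-nonZero 1≤t
    q≡ : q ≡ suc (t + k)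
    q≡ = ≤-antisym q≤ (*-cancelʳ-≤ (suc (t + k)) q t (≤-trans suc[t+k]*t≤ (≤-reflexive (sym q*t≡))))

lemma3p3 : ∀ {q : ℕ} (Π : ProjectivePlane q) (t : ℕ) → 1 ≤ t → t < q →
  (S : Fin (ProjectivePlane.nP Π) → Bool) → IsSemiarc Π t S →
  (ℓ₁ ℓ₂ : Fin (ProjectivePlane.nL Π)) → ℓ₁ ≢ ℓ₂ →
  (∃ λ P → (ProjectivePlane._I_ Π P ℓ₁ ≡ true) × (ProjectivePlane._I_ Π P ℓ₂ ≡ true) × (S P ≡ true)) →
  let n = count (λ Q → ProjectivePlane._I_ Π Q ℓ₁ ∧ not (S Q ∨ ProjectivePlane._I_ Π Q ℓ₂))
      m = count (λ Q → ProjectivePlane._I_ Π Q ℓ₂ ∧ not (S Q ∨ ProjectivePlane._I_ Π Q ℓ₁))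
  in (q * t ≤ (t + 1) * t + n * m) ×
     (q * t ≡ (t + 1) * t + n * m →
      count (λ Q → S Q ∧ not (ProjectivePlane._I_ Π Q ℓ₁ ∨ ProjectivePlane._I_ Π Q ℓ₂)) ≡ q ∸ 1 ∸ t)
lemma3p3 Π t 1≤t t<q S (_ , tangents) ℓ₁ ℓ₂ ℓ₁≢ℓ₂ (P , P∈ℓ₁ , P∈ℓ₂ , P∈S) =
  q*t-bound-with-equality 1≤t (q≤suc[t+K] (≤-trans 1≤t (<⇒≤ t<q))) K*t≤outside*outside
  where open Configuration Π S tangents ℓ₁≢ℓ₂ P∈ℓ₁ P∈ℓ₂ P∈S
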